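{- Let $(V,\phi,D)$ be a digit system, let $W$ be an abelian group, let $\pi:V\to W$ be a surjective homomorphism and $\psi:W\to W$ a homomorphism with $\pi\circ\phi=\psi\circ\pi$. Then $(W,\psi,\pi(D))$ is a digit system. If $(V,\phi,D)$ is a number system, then so is $(W,\psi,\pi(D))$.
   Context: A digit system is a triple $(V,\phi,D)$ with $V$ an abelian group, $\phi:V\to V$ a homomorphism with finite cokernel $V/\phi(V)$, and $D\subseteq V$ a finite subset meeting every coset of $\phi(V)$. It has the Finite Expansion Property (and is then called a number system) if every $v\in V$ can be written as $v=\sum_{i=0}^{\ell}\phi^i(d_i)$ with $d_i\in D$. -}

module Defs where

open import Level using (Level; _⊔_)
open import Data.Nat using (ℕ; zero; suc)
open import Data.List using (List; []; _∷_)
open import Data.List.Membership.Propositional using (_∈_)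
open import Data.List.Relation.Unary.All using (All)
open import Data.Product using (Σ; ∃; _×_; _,_)
open import Algebra.Bundles using (AbelianGroup)
open import Algebra.Morphism.Structures using (module GroupMorphisms)

private variable c ℓ c′ ℓ′ : Level

module _ (G : AbelianGroup c ℓ) where
  open AbelianGroup G

  IsEndo : (Carrier → Carrier) → Set (c ⊔ ℓ)
  IsEndo φ = GroupMorphisms.IsGroupHomomorphism rawGroup rawGroup φ

  iter : (Carrier → Carrier) → ℕ → Carrier → Carrier
  iter φ zero x = x
  iter φ (suc i) x = φ (iter φ i x)

  digitSumFrom : (Carrier → Carrier) → ℕ → List Carrier → Carrier
  digitSumFrom φ i [] = ε
  digitSumFrom φ i (d ∷ ds) = iter φ i d ∙ digitSumFrom φ (suc i) ds

  SameCoset : (Carrier → Carrier) → Carrier → Carrier → Set (c ⊔ ℓ)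
  SameCoset φ v w = ∃ λ u → v ≈ w ∙ φ u

  FiniteCokernel : (Carrier → Carrier) → Set (c ⊔ ℓ)
  FiniteCokernel φ = Σ (List Carrier) λ R → ∀ v → ∃ λ r → r ∈ R × SameCoset φ v r

  -- (G, φ, D) is a digit system; D a finite subset given as a list
  record IsDigitSystem (φ : Carrier → Carrier) (D : List Carrier) : Set (c ⊔ ℓ) where
    field
      homo         : IsEndo φ
      finCoker     : FiniteCokernel φ
      meetsCosets  : ∀ v → ∃ λ d → d ∈ D × SameCoset φ v d

  FiniteExpansionProperty : (Carrier → Carrier) → List Carrier → Set (c ⊔ ℓ)
  FiniteExpansionProperty φ D =
    ∀ v → Σ Carrier λ d₀ → Σ (List Carrier) λ ds →
      All (_∈ D) (d₀ ∷ ds) × v ≈ digitSumFrom φ 0 (d₀ ∷ ds)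

  record IsNumberSystem (φ : Carrier → Carrier) (D : List Carrier) : Set (c ⊔ ℓ) where
    field
      digitSystem : IsDigitSystem φ D
      fep         : FiniteExpansionProperty φ D

{-# OPTIONS --safe #-}
module Submission where

open import Defs
open import Data.Nat using (zero; suc)
open import Data.List using (List; map; []; _∷_)
open import Data.List.Membership.Propositional using (_∈_)
open import Data.List.Membership.Propositional.Properties using (∈-map⁺)
import Data.List.Relation.Unary.All as All
open import Data.List.Relation.Unary.All.Properties using (map⁺)
open import Data.Product using (∃; _×_; _,_)
open import Algebra.Bundles using (AbelianGroup)
open import Algebra.Morphism.Structures using (module GroupMorphisms)
import Relation.Binary.Reasoning.Setoid as SetoidReasoning

-- Everything is pushed forward along π: cosets of φ(V) map into cosets of ψ(W)
-- because π ∘ φ = ψ ∘ π, and expansions map to expansions because π is additive.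
-- Surjectivity of π makes the images of coset representatives, of D and of
-- all expansions exhaust W.

module Semiconjugacy {c ℓ c′ ℓ′} (V : AbelianGroup c ℓ) (W : AbelianGroup c′ ℓ′)
  {φ : AbelianGroup.Carrier V → AbelianGroup.Carrier V}
  {π : AbelianGroup.Carrier V → AbelianGroup.Carrier W}
  {ψ : AbelianGroup.Carrier W → AbelianGroup.Carrier W}
  (π-homo : GroupMorphisms.IsGroupHomomorphism (AbelianGroup.rawGroup V) (AbelianGroup.rawGroup W) π)
  (ψ-homo : IsEndo W ψ)
  (π∘φ≈ψ∘π : ∀ v → AbelianGroup._≈_ W (π (φ v)) (ψ (π v)))
  where

  private
    module V = AbelianGroup V
    module Π = GroupMorphisms.IsGroupHomomorphism π-homo
    module Ψ = GroupMorphisms.IsGroupHomomorphism ψ-homo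
  open AbelianGroup W
  open SetoidReasoning setoid

  π-iter : ∀ i v → π (iter V φ i v) ≈ iter W ψ i (π v)
  π-iter zero    v = refl
  π-iter (suc i) v = trans (π∘φ≈ψ∘π (iter V φ i v)) (Ψ.⟦⟧-cong (π-iter i v))

  π-digitSumFrom : ∀ i ds → π (digitSumFrom V φ i ds) ≈ digitSumFrom W ψ i (map π ds)
  π-digitSumFrom i []       = Π.ε-homo
  π-digitSumFrom i (d ∷ ds) = begin
    π (iter V φ i d V.∙ digitSumFrom V φ (suc i) ds)      ≈⟨ Π.homo _ _ ⟩
    π (iter V φ i d) ∙ π (digitSumFrom V φ (suc i) ds)    ≈⟨ ∙-cong (π-iter i d) (π-digitSumFrom (suc i) ds) ⟩
    iter W ψ i (π d) ∙ digitSumFrom W ψ (suc i) (map π ds) ∎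

  π-SameCoset : ∀ {v r w} → π v ≈ w → SameCoset V φ v r → SameCoset W ψ w (π r)
  π-SameCoset {v} {r} {w} πv≈w (u , v≈r+φu) = π u , (begin
    w               ≈⟨ sym πv≈w ⟩
    π v             ≈⟨ Π.⟦⟧-cong v≈r+φu ⟩
    π (r V.∙ φ u)   ≈⟨ Π.homo r (φ u) ⟩
    π r ∙ π (φ u)   ≈⟨ ∙-congˡ (π∘φ≈ψ∘π u) ⟩
    π r ∙ ψ (π u)   ∎)

  module Surjective (π-surjective : ∀ w → ∃ λ v → π v ≈ w) where

    meetsCosets-map : ∀ {R} → (∀ v → ∃ λ r → r ∈ R × SameCoset V φ v r) →
                      ∀ w → ∃ λ r → r ∈ map π R × SameCoset W ψ w r
    meetsCosets-map meets w with π-surjective w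
    ... | v , πv≈w with meets v
    ... | r , r∈R , v~r = π r , ∈-map⁺ π r∈R , π-SameCoset πv≈w v~r

    finiteCokernel-map : FiniteCokernel V φ → FiniteCokernel W ψ
    finiteCokernel-map (R , meets) = map π R , meetsCosets-map meets

    isDigitSystem-map : ∀ {D} → IsDigitSystem V φ D → IsDigitSystem W ψ (map π D)
    isDigitSystem-map ds = record
      { homo        = ψ-homo
      ; finCoker    = finiteCokernel-map finCoker
      ; meetsCosets = meetsCosets-map meetsCosets
      } where open IsDigitSystem ds

    finiteExpansionProperty-map : ∀ {D} → FiniteExpansionProperty V φ D →
                                  FiniteExpansionProperty W ψ (map π D)
    finiteExpansionProperty-map fep w with π-surjective w
    ... | v , πv≈w with fep v
    ... | d₀ , ds , digits∈D , v≈sum =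
      π d₀ , map π ds , map⁺ (All.map (∈-map⁺ π) digits∈D) , (begin
        w                                   ≈⟨ sym πv≈w ⟩
        π v                                 ≈⟨ Π.⟦⟧-cong v≈sum ⟩
        π (digitSumFrom V φ 0 (d₀ ∷ ds))    ≈⟨ π-digitSumFrom 0 (d₀ ∷ ds) ⟩
        digitSumFrom W ψ 0 (map π (d₀ ∷ ds)) ∎)

    isNumberSystem-map : ∀ {D} → IsNumberSystem V φ D → IsNumberSystem W ψ (map π D)
    isNumberSystem-map ns = record
      { digitSystem = isDigitSystem-map digitSystem
      ; fep         = finiteExpansionProperty-map fep
      } where open IsNumberSystem ns

lemma3p1 : ∀ {c ℓ c′ ℓ′} (V : AbelianGroup c ℓ) (W : AbelianGroup c′ ℓ′)
    (φ : AbelianGroup.Carrier V → AbelianGroup.Carrier V)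
    (D : List (AbelianGroup.Carrier V))
    (π : AbelianGroup.Carrier V → AbelianGroup.Carrier W)
    (ψ : AbelianGroup.Carrier W → AbelianGroup.Carrier W) →
    IsDigitSystem V φ D →
    GroupMorphisms.IsGroupHomomorphism (AbelianGroup.rawGroup V) (AbelianGroup.rawGroup W) π →
    (∀ w → ∃ λ v → AbelianGroup._≈_ W (π v) w) →
    IsEndo W ψ →
    (∀ v → AbelianGroup._≈_ W (π (φ v)) (ψ (π v))) →
    IsDigitSystem W ψ (map π D)
      × (IsNumberSystem V φ D → IsNumberSystem W ψ (map π D))
lemma3p1 V W φ D π ψ ds π-homo π-surjective ψ-homo π∘φ≈ψ∘π =
  isDigitSystem-map ds , isNumberSystem-map
  where open Semiconjugacy.Surjective V W {φ = φ} π-homo ψ-homo π∘φ≈ψ∘π π-surjective
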